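{- For every integer $n \ge 7$ with $n \equiv 0,2 \pmod{7}$, there is a unique binary LCD $[n,3,\lfloor 4n/7 \rfloor - 1]$ code, up to equivalence.
   Context: All codes are binary linear codes; an $[n,k,d]$ code is a $k$-dimensional subspace of $\mathbb{F}_2^n$ with minimum nonzero Hamming weight $d$. A code $C$ is LCD if $C \cap C^\perp = \{\mathbf{0}_n\}$, where $C^\perp$ is the dual with respect to the standard inner product. Two binary codes are equivalent if one is obtained from the other by a permutation of coordinates. -}

module Defs where

open import Data.Nat using (ℕ; zero; suc; _+_; _≤_)
open import Data.Bool using (Bool; true; false; _xor_; _∧_)
open import Data.Vec using (Vec; []; _∷_; replicate; zipWith; foldr; lookup; tabulate; count)
open import Data.Bool.Properties using (T?)
open import Data.Fin using (Fin)
open import Data.Fin.Permutation using (Permutation′; _⟨$⟩ʳ_)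
open import Data.Product using (Σ; ∃; _×_; _,_)
open import Relation.Binary.PropositionalEquality using (_≡_)
open import Relation.Nullary using (¬_)
open import Function.Bundles using (_⇔_)

-- Vectors of 𝔽₂ⁿ, with 𝔽₂ = Bool (false = 0, true = 1, xor = +, ∧ = ·)
Word : ℕ → Set
Word n = Vec Bool n

0w : ∀ {n} → Word n
0w = replicate _ false

_⊕_ : ∀ {n} → Word n → Word n → Word n
_⊕_ = zipWith _xor_

⟨_,_⟩ : ∀ {n} → Word n → Word n → Bool
⟨ u , v ⟩ = foldr _ _xor_ false (zipWith _∧_ u v)

wt : ∀ {n} → Word n → ℕ
wt w = count T? w

comb : ∀ {k n} → Vec (Word n) k → Vec Bool k → Word n
comb []       []       = 0w
comb (g ∷ G) (c ∷ cs) = (if′ c g) ⊕ comb G cs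
  where
  if′ : Bool → Word _ → Word _
  if′ true  x = x
  if′ false _ = 0w

-- A binary linear [n,k] code: a k-dimensional subspace of 𝔽₂ⁿ, presented
-- by a generator matrix whose k rows are linearly independent.
record LinearCode (n k : ℕ) : Set where
  field
    gen   : Vec (Word n) k
    indep : ∀ (c : Vec Bool k) → comb gen c ≡ 0w → c ≡ replicate k false

open LinearCode public

_∈C_ : ∀ {n k} → Word n → LinearCode n k → Set
w ∈C C = ∃ λ c → comb (gen C) c ≡ w

_∈C⊥_ : ∀ {n k} → Word n → LinearCode n k → Set
w ∈C⊥ C = ∀ u → u ∈C C → ⟨ u , w ⟩ ≡ false

IsLCD : ∀ {n k} → LinearCode n k → Set
IsLCD {n} C = ∀ (w : Word n) → w ∈C C → w ∈C⊥ C → w ≡ 0w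

HasMinDist : ∀ {n k} → LinearCode n k → ℕ → Set
HasMinDist {n} C d =
  (∀ (w : Word n) → w ∈C C → ¬ (w ≡ 0w) → d ≤ wt w) ×
  (∃ λ (w : Word n) → w ∈C C × ¬ (w ≡ 0w) × wt w ≡ d)

permuteW : ∀ {n} → Permutation′ n → Word n → Word n
permuteW σ w = tabulate (λ i → lookup w (σ ⟨$⟩ʳ i))

Equivalent : ∀ {n k} → LinearCode n k → LinearCode n k → Set
Equivalent {n} C C′ =
  Σ (Permutation′ n) λ σ → ∀ (w : Word n) → (w ∈C C) ⇔ (permuteW σ w ∈C C′)

-- A binary [n,3] code is determined up to equivalence by the multiset of its columns in 𝔽₂³, i.e.
-- by a histogram h on 𝔽₂³. The codeword of c ∈ 𝔽₂³ has weight W_c = Σ_{⟨c,x⟩=1} h_x, and the code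
-- is LCD iff its Gram map c ↦ Σ_x h_x ⟨c,x⟩ x is injective, which depends on h only modulo 2.
-- Write n = 7 + 2r + 7m and d = 3 + r + 4m with r ∈ {0,1}. Counting gives Σ_{c≠0} (W_c − d) + 4 h₀ = 7 + r,
-- so the excess vector e = (W_c − d)_{c≠0} ranges over a finite set, and the weights determine the
-- histogram through 2 Σ_{⟨u,v⟩=1} W_u = Σ_u W_u + 4 h_v, i.e. h_v = m − 2 + j_v with j computable
-- from e. An exhaustive check shows that every e either admits no histogram, gives a non-injective
-- Gram map, or gives h₀ = 0 and a j obtained by an invertible change of basis from the histogram of
-- one fixed code (a short base code followed by m copies of the simplex code). Equal histograms up
-- to that change of basis then yield the coordinate permutation.

module Submission where

open import Defs
open import Algebra.Bundles using (CommutativeRing)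
open import Data.Bool using (Bool; true; false; _xor_; _∧_; not; T; if_then_else_)
import Data.Bool.Properties as Boolₚ
open import Data.Empty using (⊥-elim)
open import Data.Fin using (Fin; zero; suc; punchIn; #_)
open import Data.Fin.Permutation using (Permutation′; _⟨$⟩ʳ_; _⟨$⟩ˡ_; inverseʳ; insert; insert-punchIn)
import Data.Fin.Permutation as Perm
open import Data.Fin.Properties using (all?; any?; 0≢1+n) renaming (_≟_ to _≟ᶠ_)
open import Data.List using (List; concatMap; filter)
import Data.List as List
open import Data.List.Relation.Unary.Any using (Any)
import Data.List.Relation.Unary.Any as Any
open import Data.Nat using (ℕ; zero; suc; _+_; _*_; _∸_; _≤_; _<_; z≤n; s≤s)
open import Data.Nat.DivMod using (_/_; _%_)
import Data.Nat.DivMod as DivMod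
open import Data.Nat.Divisibility using (_∣_; _∣?_; divides; ∣m+n∣m⇒∣n; m∣m*n; n∣m*n; n/m≡quotient)
import Data.Nat.Properties as ℕₚ
open import Data.Nat.Tactic.RingSolver using (solve-∀)
open import Data.Product using (Σ; ∃; _×_; _,_; proj₁; proj₂)
open import Data.Sum using (_⊎_; inj₁; inj₂)
open import Data.Unit using (tt)
open import Data.Vec using (Vec; []; _∷_; lookup; map; tabulate; replicate; zipWith; _++_; sum; updateAt; removeAt; toList)
import Data.Vec.Properties as Vecₚ
open import Data.Vec.Relation.Binary.Pointwise.Extensional using (ext; Pointwise-≡⇒≡)
open import Function.Bundles using (mk⇔; Equivalence)
open import Relation.Binary.PropositionalEquality using (_≡_; _≢_; refl; sym; trans; cong; cong₂; subst; module ≡-Reasoning)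
open import Relation.Nullary using (Dec; yes; no; ¬_)
open import Relation.Nullary.Decidable using (toWitness; isYes; _→-dec_; _×-dec_; _⊎-dec_; ¬?)
open import Algebra.Properties.CommutativeSemigroup
  (CommutativeRing.+-commutativeSemigroup Boolₚ.xor-∧-commutativeRing) using () renaming (interchange to xor-interchange)

-- Words over 𝔽₂

⊕-assoc : ∀ {n} (x y z : Word n) → (x ⊕ y) ⊕ z ≡ x ⊕ (y ⊕ z)
⊕-assoc []      []      []      = refl
⊕-assoc (a ∷ x) (b ∷ y) (c ∷ z) = cong₂ _∷_ (Boolₚ.xor-assoc a b c) (⊕-assoc x y z)

⊕-comm : ∀ {n} (x y : Word n) → x ⊕ y ≡ y ⊕ x
⊕-comm []      []      = refl
⊕-comm (a ∷ x) (b ∷ y) = cong₂ _∷_ (Boolₚ.xor-comm a b) (⊕-comm x y)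

⊕-identityˡ : ∀ {n} (x : Word n) → 0w ⊕ x ≡ x
⊕-identityˡ []      = refl
⊕-identityˡ (a ∷ x) = cong (a ∷_) (⊕-identityˡ x)

⊕-identityʳ : ∀ {n} (x : Word n) → x ⊕ 0w ≡ x
⊕-identityʳ x = trans (⊕-comm x 0w) (⊕-identityˡ x)

⊕-self : ∀ {n} (x : Word n) → x ⊕ x ≡ 0w
⊕-self []      = refl
⊕-self (a ∷ x) = cong₂ _∷_ (Boolₚ.xor-same a) (⊕-self x)

⊕-interchange : ∀ {n} (w x y z : Word n) → (w ⊕ x) ⊕ (y ⊕ z) ≡ (w ⊕ y) ⊕ (x ⊕ z)
⊕-interchange []      []      []      []      = refl
⊕-interchange (a ∷ w) (b ∷ x) (c ∷ y) (d ∷ z) = cong₂ _∷_ (xor-interchange a b c d) (⊕-interchange w x y z)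

⟨⟩-zeroˡ : ∀ {n} (x : Word n) → ⟨ 0w , x ⟩ ≡ false
⟨⟩-zeroˡ []      = refl
⟨⟩-zeroˡ (a ∷ x) = ⟨⟩-zeroˡ x

⟨⟩-zeroʳ : ∀ {n} (x : Word n) → ⟨ x , 0w ⟩ ≡ false
⟨⟩-zeroʳ []      = refl
⟨⟩-zeroʳ (a ∷ x) rewrite Boolₚ.∧-zeroʳ a = ⟨⟩-zeroʳ x

⟨⟩-distribʳ-⊕ : ∀ {n} (x y z : Word n) → ⟨ x ⊕ y , z ⟩ ≡ ⟨ x , z ⟩ xor ⟨ y , z ⟩
⟨⟩-distribʳ-⊕ []      []      []      = refl
⟨⟩-distribʳ-⊕ (a ∷ x) (b ∷ y) (c ∷ z) rewrite ⟨⟩-distribʳ-⊕ x y z | Boolₚ.∧-distribʳ-xor c a b =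
  xor-interchange (a ∧ c) (b ∧ c) ⟨ x , z ⟩ ⟨ y , z ⟩

⟨⟩-distribˡ-⊕ : ∀ {n} (x y z : Word n) → ⟨ x , y ⊕ z ⟩ ≡ ⟨ x , y ⟩ xor ⟨ x , z ⟩
⟨⟩-distribˡ-⊕ []      []      []      = refl
⟨⟩-distribˡ-⊕ (a ∷ x) (b ∷ y) (c ∷ z) rewrite ⟨⟩-distribˡ-⊕ x y z | Boolₚ.∧-distribˡ-xor a b c =
  xor-interchange (a ∧ b) (a ∧ c) ⟨ x , y ⟩ ⟨ x , z ⟩

⟨⟩-nondegenerate : ∀ {n} (x : Word n) → (∀ u → ⟨ u , x ⟩ ≡ false) → x ≡ 0w
⟨⟩-nondegenerate []      _ = refl
⟨⟩-nondegenerate (a ∷ x) ⊥x =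
  cong₂ _∷_ (trans (sym (Boolₚ.xor-identityʳ a)) (trans (cong (a xor_) (sym (⟨⟩-zeroˡ x))) (⊥x (true ∷ 0w))))
            (⟨⟩-nondegenerate x (λ u → ⊥x (false ∷ u)))

-- Codes given by their columns

columns : ∀ {k n} → Vec (Word n) k → Vec (Word k) n
columns G = tabulate (λ i → map (λ g → lookup g i) G)

columns-involutive : ∀ {k n} (xs : Vec (Word k) n) → columns (columns xs) ≡ xs
columns-involutive xs = Pointwise-≡⇒≡ (ext λ i → trans (Vecₚ.lookup∘tabulate _ i)
  (Pointwise-≡⇒≡ (ext λ r → trans (Vecₚ.lookup-map r _ (columns xs))
    (trans (cong (λ g → lookup g i) (Vecₚ.lookup∘tabulate _ r)) (Vecₚ.lookup-map i _ xs)))))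

codeword : ∀ {k n} → Vec (Word k) n → Word k → Word n
codeword xs c = map (λ x → ⟨ c , x ⟩) xs

act : ∀ {k n} → Vec (Word n) k → Word n → Word k
act M v = map (λ r → ⟨ r , v ⟩) M

comb-adjoint : ∀ {k n} (M : Vec (Word n) k) c v → ⟨ comb M c , v ⟩ ≡ ⟨ c , act M v ⟩
comb-adjoint []      []           v = ⟨⟩-zeroˡ v
comb-adjoint (r ∷ M) (true ∷ c)  v = trans (⟨⟩-distribʳ-⊕ r (comb M c) v) (cong (⟨ r , v ⟩ xor_) (comb-adjoint M c v))
comb-adjoint (r ∷ M) (false ∷ c) v =
  trans (⟨⟩-distribʳ-⊕ 0w (comb M c) v) (trans (cong (_xor ⟨ comb M c , v ⟩) (⟨⟩-zeroˡ v)) (comb-adjoint M c v))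

lookup-comb : ∀ {k n} (G : Vec (Word n) k) c i → lookup (comb G c) i ≡ ⟨ c , lookup (columns G) i ⟩
lookup-comb G c i = trans (lookup-comb′ G c) (cong ⟨ c ,_⟩ (sym (Vecₚ.lookup∘tabulate _ i)))
  where
  lookup-comb′ : ∀ {k} (G : Vec (Word _) k) c → lookup (comb G c) i ≡ ⟨ c , map (λ g → lookup g i) G ⟩
  lookup-comb′ []      []          = Vecₚ.lookup-replicate i false
  lookup-comb′ (g ∷ G) (true ∷ c)  =
    trans (Vecₚ.lookup-zipWith _xor_ i g (comb G c)) (cong (lookup g i xor_) (lookup-comb′ G c))
  lookup-comb′ (g ∷ G) (false ∷ c) =
    trans (Vecₚ.lookup-zipWith _xor_ i 0w (comb G c))
      (trans (cong (_xor lookup (comb G c) i) (Vecₚ.lookup-replicate i false)) (lookup-comb′ G c))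

comb≡codeword : ∀ {k n} (G : Vec (Word n) k) c → comb G c ≡ codeword (columns G) c
comb≡codeword G c = Pointwise-≡⇒≡ (ext λ i →
  trans (lookup-comb G c i) (sym (Vecₚ.lookup-map i _ (columns G))))

comb-columns : ∀ {k n} (xs : Vec (Word k) n) c → comb (columns xs) c ≡ codeword xs c
comb-columns xs c = trans (comb≡codeword (columns xs) c) (cong (λ ys → codeword ys c) (columns-involutive xs))

-- gram xs c is G Gᵀ c for the generator matrix G whose columns are xs.
gram : ∀ {k n} → Vec (Word k) n → Word k → Word k
gram []       c = 0w
gram (x ∷ xs) c = (if ⟨ c , x ⟩ then x else 0w) ⊕ gram xs c

⟨⟩-codeword : ∀ {k n} (xs : Vec (Word k) n) c′ c → ⟨ codeword xs c′ , codeword xs c ⟩ ≡ ⟨ c′ , gram xs c ⟩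
⟨⟩-codeword []       c′ c = sym (⟨⟩-zeroʳ c′)
⟨⟩-codeword (x ∷ xs) c′ c = begin
  (⟨ c′ , x ⟩ ∧ ⟨ c , x ⟩) xor ⟨ codeword xs c′ , codeword xs c ⟩
    ≡⟨ cong₂ _xor_ (sym (⟨⟩-scale ⟨ c , x ⟩)) (⟨⟩-codeword xs c′ c) ⟩
  ⟨ c′ , (if ⟨ c , x ⟩ then x else 0w) ⟩ xor ⟨ c′ , gram xs c ⟩
    ≡⟨ sym (⟨⟩-distribˡ-⊕ c′ _ (gram xs c)) ⟩
  ⟨ c′ , gram (x ∷ xs) c ⟩ ∎
  where
  open ≡-Reasoning
  ⟨⟩-scale : ∀ t → ⟨ c′ , (if t then x else 0w) ⟩ ≡ ⟨ c′ , x ⟩ ∧ t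
  ⟨⟩-scale true  = sym (Boolₚ.∧-identityʳ _)
  ⟨⟩-scale false = trans (⟨⟩-zeroʳ c′) (sym (Boolₚ.∧-zeroʳ _))

GramInjective : ∀ {k n} → Vec (Word k) n → Set
GramInjective xs = ∀ c → gram xs c ≡ 0w → c ≡ 0w

codeword≡0⇒gram≡0 : ∀ {k n} (xs : Vec (Word k) n) c → codeword xs c ≡ 0w → gram xs c ≡ 0w
codeword≡0⇒gram≡0 xs c eq = ⟨⟩-nondegenerate (gram xs c) λ c′ →
  trans (sym (⟨⟩-codeword xs c′ c)) (trans (cong ⟨ codeword xs c′ ,_⟩ eq) (⟨⟩-zeroʳ (codeword xs c′)))

codeFromColumns : ∀ {k n} (xs : Vec (Word k) n) → GramInjective xs → LinearCode n k
codeFromColumns xs inj = record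
  { gen   = columns xs
  ; indep = λ c eq → inj c (codeword≡0⇒gram≡0 xs c
      (trans (sym (comb-columns xs c)) eq))
  }

codeword-zero : ∀ {k n} (xs : Vec (Word k) n) → codeword xs 0w ≡ 0w
codeword-zero []       = refl
codeword-zero (x ∷ xs) = cong₂ _∷_ (⟨⟩-zeroˡ x) (codeword-zero xs)

codeFromColumns-isLCD : ∀ {k n} (xs : Vec (Word k) n) (inj : GramInjective xs) → IsLCD (codeFromColumns xs inj)
codeFromColumns-isLCD xs inj w (c , refl) w⊥ = begin
  comb (columns xs) c   ≡⟨ comb-columns xs c ⟩
  codeword xs c         ≡⟨ cong (codeword xs) (inj c gram≡0) ⟩
  codeword xs 0w        ≡⟨ codeword-zero xs ⟩
  0w                    ∎
  where
  open ≡-Reasoning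
  gram≡0 : gram xs c ≡ 0w
  gram≡0 = ⟨⟩-nondegenerate (gram xs c) λ c′ → trans (sym (⟨⟩-codeword xs c′ c))
    (trans (cong₂ ⟨_,_⟩ (sym (comb-columns xs c′)) (sym (comb-columns xs c))) (w⊥ _ (c′ , refl)))

isLCD⇒gramInjective : ∀ {k n} (C : LinearCode n k) → IsLCD C → GramInjective (columns (gen C))
isLCD⇒gramInjective C lcd c gram≡0 = indep C c (lcd (comb (gen C) c) (c , refl) orthogonal)
  where
  orthogonal : comb (gen C) c ∈C⊥ C
  orthogonal u (c′ , refl) = begin
    ⟨ comb (gen C) c′ , comb (gen C) c ⟩
      ≡⟨ cong₂ ⟨_,_⟩ (comb≡codeword (gen C) c′) (comb≡codeword (gen C) c) ⟩
    ⟨ codeword (columns (gen C)) c′ , codeword (columns (gen C)) c ⟩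
      ≡⟨ ⟨⟩-codeword (columns (gen C)) c′ c ⟩
    ⟨ c′ , gram (columns (gen C)) c ⟩
      ≡⟨ cong ⟨ c′ ,_⟩ gram≡0 ⟩
    ⟨ c′ , 0w ⟩
      ≡⟨ ⟨⟩-zeroʳ c′ ⟩
    false ∎
    where open ≡-Reasoning

-- Coordinate permutations

lookup-permuteW : ∀ {n} (σ : Permutation′ n) (w : Word n) i → lookup (permuteW σ w) i ≡ lookup w (σ ⟨$⟩ʳ i)
lookup-permuteW σ w i = Vecₚ.lookup∘tabulate (λ j → lookup w (σ ⟨$⟩ʳ j)) i

permuteW-injective : ∀ {n} (σ : Permutation′ n) {u w : Word n} → permuteW σ u ≡ permuteW σ w → u ≡ w
permuteW-injective σ {u} {w} eq = Pointwise-≡⇒≡ (ext λ j → begin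
  lookup u j                        ≡⟨ cong (lookup u) (sym (inverseʳ σ)) ⟩
  lookup u (σ ⟨$⟩ʳ (σ ⟨$⟩ˡ j))       ≡⟨ sym (lookup-permuteW σ u _) ⟩
  lookup (permuteW σ u) (σ ⟨$⟩ˡ j)  ≡⟨ cong (λ x → lookup x (σ ⟨$⟩ˡ j)) eq ⟩
  lookup (permuteW σ w) (σ ⟨$⟩ˡ j)  ≡⟨ lookup-permuteW σ w _ ⟩
  lookup w (σ ⟨$⟩ʳ (σ ⟨$⟩ˡ j))       ≡⟨ cong (lookup w) (inverseʳ σ) ⟩
  lookup w j                        ∎)
  where open ≡-Reasoning

permuteW-codeword : ∀ {k n} (xs ys : Vec (Word k) n) (M : Vec (Word k) k) (σ : Permutation′ n) →
  (∀ i → lookup xs (σ ⟨$⟩ʳ i) ≡ act M (lookup ys i)) →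
  ∀ c → permuteW σ (codeword xs c) ≡ codeword ys (comb M c)
permuteW-codeword xs ys M σ matching c = Pointwise-≡⇒≡ (ext λ i → begin
  lookup (permuteW σ (codeword xs c)) i   ≡⟨ lookup-permuteW σ (codeword xs c) i ⟩
  lookup (codeword xs c) (σ ⟨$⟩ʳ i)        ≡⟨ Vecₚ.lookup-map _ _ xs ⟩
  ⟨ c , lookup xs (σ ⟨$⟩ʳ i) ⟩             ≡⟨ cong ⟨ c ,_⟩ (matching i) ⟩
  ⟨ c , act M (lookup ys i) ⟩             ≡⟨ sym (comb-adjoint M c _) ⟩
  ⟨ comb M c , lookup ys i ⟩              ≡⟨ sym (Vecₚ.lookup-map i _ ys) ⟩
  lookup (codeword ys (comb M c)) i       ∎)
  where open ≡-Reasoning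

codeword-comb-inverse : ∀ {k n} (ys : Vec (Word k) n) (M N : Vec (Word k) k) → (∀ v → act N (act M v) ≡ v) →
                        ∀ c → codeword ys (comb M (comb N c)) ≡ codeword ys c
codeword-comb-inverse ys M N NM≡id c = Vecₚ.map-cong (λ y → begin
  ⟨ comb M (comb N c) , y ⟩   ≡⟨ comb-adjoint M (comb N c) y ⟩
  ⟨ comb N c , act M y ⟩      ≡⟨ comb-adjoint N c (act M y) ⟩
  ⟨ c , act N (act M y) ⟩     ≡⟨ cong ⟨ c ,_⟩ (NM≡id y) ⟩
  ⟨ c , y ⟩                   ∎) ys
  where open ≡-Reasoning

equivalent-if-columns-match : ∀ {k n} (xs : Vec (Word k) n) (inj : GramInjective xs) (C′ : LinearCode n k)
  (M N : Vec (Word k) k) → (∀ v → act N (act M v) ≡ v) → (σ : Permutation′ n) →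
  (∀ i → lookup xs (σ ⟨$⟩ʳ i) ≡ act M (lookup (columns (gen C′)) i)) →
  Equivalent (codeFromColumns xs inj) C′
equivalent-if-columns-match xs inj C′ M N NM≡id σ matching = σ , λ w → mk⇔ (to w) (from w)
  where
  G′ = gen C′
  ys = columns G′
  to : ∀ w → w ∈C codeFromColumns xs inj → permuteW σ w ∈C C′
  to w (c , refl) = comb M c , (begin
    comb G′ (comb M c)                    ≡⟨ comb≡codeword G′ (comb M c) ⟩
    codeword ys (comb M c)                ≡⟨ sym (permuteW-codeword xs ys M σ matching c) ⟩
    permuteW σ (codeword xs c)            ≡⟨ cong (permuteW σ) (sym (comb-columns xs c)) ⟩
    permuteW σ (comb (columns xs) c)      ∎)
    where open ≡-Reasoning
  from : ∀ w → permuteW σ w ∈C C′ → w ∈C codeFromColumns xs inj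
  from w (c′ , eq) = comb N c′ , trans (comb-columns xs (comb N c′)) (permuteW-injective σ (begin
    permuteW σ (codeword xs (comb N c′))      ≡⟨ permuteW-codeword xs ys M σ matching (comb N c′) ⟩
    codeword ys (comb M (comb N c′))          ≡⟨ codeword-comb-inverse ys M N NM≡id c′ ⟩
    codeword ys c′                            ≡⟨ sym (comb≡codeword G′ c′) ⟩
    comb G′ c′                                ≡⟨ eq ⟩
    permuteW σ w                              ∎))
    where open ≡-Reasoning

-- The space 𝔽₂³ and histograms of columns

F₂³ : Set
F₂³ = Word 3

Matrix : Set
Matrix = Vec F₂³ 3

-- point i has the binary digits of i as coordinates, least significant first.
point : Fin 8 → F₂³
point zero                                      = false ∷ false ∷ false ∷ []
point (suc zero)                                = true  ∷ false ∷ false ∷ []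
point (suc (suc zero))                          = false ∷ true  ∷ false ∷ []
point (suc (suc (suc zero)))                    = true  ∷ true  ∷ false ∷ []
point (suc (suc (suc (suc zero))))              = false ∷ false ∷ true  ∷ []
point (suc (suc (suc (suc (suc zero)))))        = true  ∷ false ∷ true  ∷ []
point (suc (suc (suc (suc (suc (suc zero))))))  = false ∷ true  ∷ true  ∷ []
point (suc (suc (suc (suc (suc (suc (suc zero))))))) = true ∷ true ∷ true ∷ []

index : F₂³ → Fin 8
index (false ∷ false ∷ false ∷ []) = zero
index (true  ∷ false ∷ false ∷ []) = suc zero
index (false ∷ true  ∷ false ∷ []) = suc (suc zero)
index (true  ∷ true  ∷ false ∷ []) = suc (suc (suc zero))
index (false ∷ false ∷ true  ∷ []) = suc (suc (suc (suc zero)))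
index (true  ∷ false ∷ true  ∷ []) = suc (suc (suc (suc (suc zero))))
index (false ∷ true  ∷ true  ∷ []) = suc (suc (suc (suc (suc (suc zero)))))
index (true  ∷ true  ∷ true  ∷ []) = suc (suc (suc (suc (suc (suc (suc zero))))))

point-index : ∀ x → point (index x) ≡ x
point-index (false ∷ false ∷ false ∷ []) = refl
point-index (true  ∷ false ∷ false ∷ []) = refl
point-index (false ∷ true  ∷ false ∷ []) = refl
point-index (true  ∷ true  ∷ false ∷ []) = refl
point-index (false ∷ false ∷ true  ∷ []) = refl
point-index (true  ∷ false ∷ true  ∷ []) = refl
point-index (false ∷ true  ∷ true  ∷ []) = refl
point-index (true  ∷ true  ∷ true  ∷ []) = refl

index-point : ∀ i → index (point i) ≡ i
index-point zero                                      = refl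
index-point (suc zero)                                = refl
index-point (suc (suc zero))                          = refl
index-point (suc (suc (suc zero)))                    = refl
index-point (suc (suc (suc (suc zero))))              = refl
index-point (suc (suc (suc (suc (suc zero)))))        = refl
index-point (suc (suc (suc (suc (suc (suc zero))))))  = refl
index-point (suc (suc (suc (suc (suc (suc (suc zero))))))) = refl

index-injective : ∀ {x y} → index x ≡ index y → x ≡ y
index-injective {x} {y} eq = trans (sym (point-index x)) (trans (cong point eq) (point-index y))

_≟³_ : (x y : F₂³) → Dec (x ≡ y)
_≟³_ = Vecₚ.≡-dec Boolₚ._≟_

points : Vec F₂³ 8
points = tabulate point

lookup-points-index : ∀ x → lookup points (index x) ≡ x
lookup-points-index x = trans (Vecₚ.lookup∘tabulate point (index x)) (point-index x)

nonzero : Fin 7 → F₂³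
nonzero i = point (suc i)

nonzero≢0 : ∀ i → nonzero i ≢ 0w
nonzero≢0 i eq = 0≢1+n (trans (sym (cong index eq)) (index-point (suc i)))

∀-via-points : ∀ {P : F₂³ → Set} → (∀ x → P (point x)) → ∀ v → P v
∀-via-points {P} all-points v = subst P (point-index v) (all-points (index v))

zero-or-nonzero : ∀ c → c ≡ 0w ⊎ ∃ λ i → c ≡ nonzero i
zero-or-nonzero c with index c in eq
... | zero  = inj₁ (trans (sym (point-index c)) (cong point eq))
... | suc i = inj₂ (i , trans (sym (point-index c)) (cong point eq))

histogram : ∀ {n} → Vec F₂³ n → Vec ℕ 8
histogram []       = replicate 8 0
histogram (x ∷ xs) = updateAt (histogram xs) (index x) suc

sum-updateAt-suc : ∀ {k} (h : Vec ℕ k) i → sum (updateAt h i suc) ≡ suc (sum h)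
sum-updateAt-suc (x ∷ h) zero    = refl
sum-updateAt-suc (x ∷ h) (suc i) = trans (cong (x +_) (sum-updateAt-suc h i)) (ℕₚ.+-suc x (sum h))

sum-histogram : ∀ {n} (xs : Vec F₂³ n) → sum (histogram xs) ≡ n
sum-histogram []       = refl
sum-histogram (x ∷ xs) = trans (sum-updateAt-suc (histogram xs) (index x)) (cong suc (sum-histogram xs))

histogram-map : ∀ {n} (xs : Vec F₂³ n) (f g : F₂³ → F₂³) → (∀ v → g (f v) ≡ v) → (∀ v → f (g v) ≡ v) →
  ∀ i → lookup (histogram (map f xs)) i ≡ lookup (histogram xs) (index (g (point i)))
histogram-map []       f g gf fg i = trans (Vecₚ.lookup-replicate i 0) (sym (Vecₚ.lookup-replicate (index (g (point i))) 0))
histogram-map (x ∷ xs) f g gf fg i with index (f x) ≟ᶠ i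
... | yes fx≡i = begin
  lookup (updateAt (histogram (map f xs)) (index (f x)) suc) i   ≡⟨ cong (λ j → lookup (updateAt (histogram (map f xs)) j suc) i) fx≡i ⟩
  lookup (updateAt (histogram (map f xs)) i suc) i               ≡⟨ Vecₚ.lookup∘updateAt i (histogram (map f xs)) ⟩
  suc (lookup (histogram (map f xs)) i)                          ≡⟨ cong suc (histogram-map xs f g gf fg i) ⟩
  suc (lookup (histogram xs) (index (g (point i))))              ≡⟨ cong (λ j → suc (lookup (histogram xs) j)) gi≡x ⟩
  suc (lookup (histogram xs) (index x))                          ≡⟨ sym (Vecₚ.lookup∘updateAt (index x) (histogram xs)) ⟩
  lookup (updateAt (histogram xs) (index x) suc) (index x)       ≡⟨ cong (lookup (updateAt (histogram xs) (index x) suc)) (sym gi≡x) ⟩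
  lookup (updateAt (histogram xs) (index x) suc) (index (g (point i))) ∎
  where
  open ≡-Reasoning
  gi≡x : index (g (point i)) ≡ index x
  gi≡x = cong index (trans (cong g (trans (cong point (sym fx≡i)) (point-index (f x)))) (gf x))
... | no fx≢i = begin
  lookup (updateAt (histogram (map f xs)) (index (f x)) suc) i
    ≡⟨ Vecₚ.lookup∘updateAt′ i (index (f x)) (λ e → fx≢i (sym e)) (histogram (map f xs)) ⟩
  lookup (histogram (map f xs)) i                                ≡⟨ histogram-map xs f g gf fg i ⟩
  lookup (histogram xs) (index (g (point i)))                    ≡⟨ sym (Vecₚ.lookup∘updateAt′ _ (index x) gi≢x (histogram xs)) ⟩
  lookup (updateAt (histogram xs) (index x) suc) (index (g (point i))) ∎
  where
  open ≡-Reasoning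
  gi≢x : index (g (point i)) ≢ index x
  gi≢x e = fx≢i (trans (cong (λ y → index (f y)) (sym (index-injective e))) (trans (cong index (fg (point i))) (index-point i)))

occurrence : ∀ {n} (xs : Vec F₂³ n) y → 0 < lookup (histogram xs) (index y) → ∃ λ k → lookup xs k ≡ y
occurrence []       y pos = ⊥-elim (ℕₚ.<-irrefl (sym (Vecₚ.lookup-replicate (index y) 0)) pos)
occurrence (x ∷ xs) y pos with x ≟³ y
... | yes x≡y = zero , x≡y
... | no  x≢y with occurrence xs y
      (subst (0 <_) (Vecₚ.lookup∘updateAt′ (index y) (index x) (λ e → x≢y (sym (index-injective e))) (histogram xs)) pos)
...   | k , xₖ≡y = suc k , xₖ≡y

updateAt-suc-comm : ∀ {k} (v : Vec ℕ k) i j → updateAt (updateAt v i suc) j suc ≡ updateAt (updateAt v j suc) i suc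
updateAt-suc-comm (x ∷ v) zero    zero    = refl
updateAt-suc-comm (x ∷ v) zero    (suc j) = refl
updateAt-suc-comm (x ∷ v) (suc i) zero    = refl
updateAt-suc-comm (x ∷ v) (suc i) (suc j) = cong (x ∷_) (updateAt-suc-comm v i j)

updateAt-suc-injective : ∀ {k} (a b : Vec ℕ k) i → updateAt a i suc ≡ updateAt b i suc → a ≡ b
updateAt-suc-injective (x ∷ a) (y ∷ b) zero    eq = cong₂ _∷_ (ℕₚ.suc-injective (Vecₚ.∷-injectiveˡ eq)) (Vecₚ.∷-injectiveʳ eq)
updateAt-suc-injective (x ∷ a) (y ∷ b) (suc i) eq =
  cong₂ _∷_ (Vecₚ.∷-injectiveˡ eq) (updateAt-suc-injective a b i (Vecₚ.∷-injectiveʳ eq))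

histogram-removeAt : ∀ {n} (xs : Vec F₂³ (suc n)) k → histogram xs ≡ updateAt (histogram (removeAt xs k)) (index (lookup xs k)) suc
histogram-removeAt (x ∷ xs)          zero    = refl
histogram-removeAt (x ∷ xs@(_ ∷ _)) (suc k) =
  trans (cong (λ h → updateAt h (index x) suc) (histogram-removeAt xs k))
        (updateAt-suc-comm (histogram (removeAt xs k)) (index (lookup xs k)) (index x))

lookup-removeAt : ∀ {A : Set} {n} (xs : Vec A (suc n)) k j → lookup (removeAt xs k) j ≡ lookup xs (punchIn k j)
lookup-removeAt xs k j = trans (sym (Vecₚ.insertAt-punchIn (removeAt xs k) k (lookup xs k) j))
                               (cong (λ ys → lookup ys (punchIn k j)) (Vecₚ.insertAt-removeAt xs k))

histogram-permutation : ∀ {n} (xs ys : Vec F₂³ n) → histogram xs ≡ histogram ys →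
  ∃ λ (σ : Permutation′ n) → ∀ i → lookup xs (σ ⟨$⟩ʳ i) ≡ lookup ys i
histogram-permutation []       []       _  = Perm.id , λ ()
histogram-permutation (x ∷ xs) (y ∷ ys) eq with occurrence (x ∷ xs) y (subst (λ h → 0 < lookup h (index y)) (sym eq)
                                                  (subst (0 <_) (sym (Vecₚ.lookup∘updateAt (index y) (histogram ys))) (s≤s z≤n)))
... | k , xₖ≡y with histogram-permutation (removeAt (x ∷ xs) k) ys (updateAt-suc-injective _ _ (index y)
                      (trans (cong (λ v → updateAt (histogram (removeAt (x ∷ xs) k)) (index v) suc) (sym xₖ≡y))
                             (trans (sym (histogram-removeAt (x ∷ xs) k)) eq)))
...   | τ , τ-matches = insert zero k τ , matches
  where
  matches : ∀ i → lookup (x ∷ xs) (insert zero k τ ⟨$⟩ʳ i) ≡ lookup (y ∷ ys) i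
  matches zero    = xₖ≡y
  matches (suc i) = trans (cong (lookup (x ∷ xs)) (insert-punchIn zero k τ i))
                          (trans (sym (lookup-removeAt (x ∷ xs) k (τ ⟨$⟩ʳ i))) (τ-matches i))

-- Linear forms on ℕ-vectors

infixl 7 _·_
infixl 6 _+ᵛ_

_·_ : ∀ {k} → Vec ℕ k → Vec ℕ k → ℕ
[]      · []      = 0
(x ∷ a) · (y ∷ h) = x * y + a · h

_+ᵛ_ : ∀ {k} → Vec ℕ k → Vec ℕ k → Vec ℕ k
_+ᵛ_ = zipWith _+_

_*ᵛ_ : ∀ {k} → ℕ → Vec ℕ k → Vec ℕ k
c *ᵛ a = map (c *_) a

unit : ∀ {k} → Fin k → Vec ℕ k
unit i = updateAt (replicate _ 0) i suc

lincomb : ∀ {r k} → Vec ℕ r → Vec (Vec ℕ k) r → Vec ℕ k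
lincomb []       []       = replicate _ 0
lincomb (a ∷ as) (v ∷ vs) = a *ᵛ v +ᵛ lincomb as vs

_≟ᵛ_ : ∀ {k} (a b : Vec ℕ k) → Dec (a ≡ b)
_≟ᵛ_ = Vecₚ.≡-dec ℕₚ._≟_

·-comm : ∀ {k} (a h : Vec ℕ k) → a · h ≡ h · a
·-comm []      []      = refl
·-comm (x ∷ a) (z ∷ h) = cong₂ _+_ (ℕₚ.*-comm x z) (·-comm a h)

·-zeroˡ : ∀ {k} (h : Vec ℕ k) → replicate k 0 · h ≡ 0
·-zeroˡ []      = refl
·-zeroˡ (x ∷ h) = ·-zeroˡ h

·-zeroʳ : ∀ {k} (a : Vec ℕ k) → a · replicate k 0 ≡ 0
·-zeroʳ []      = refl
·-zeroʳ (x ∷ a) = trans (cong (_+ a · replicate _ 0) (ℕₚ.*-zeroʳ x)) (·-zeroʳ a)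

·-distribʳ-+ᵛ : ∀ {k} (a b h : Vec ℕ k) → (a +ᵛ b) · h ≡ a · h + b · h
·-distribʳ-+ᵛ []      []      []      = refl
·-distribʳ-+ᵛ (x ∷ a) (y ∷ b) (z ∷ h) rewrite ·-distribʳ-+ᵛ a b h = lemma x y z (a · h) (b · h)
  where
  lemma : ∀ x y z s t → (x + y) * z + (s + t) ≡ (x * z + s) + (y * z + t)
  lemma = solve-∀

·-*ᵛ : ∀ {k} c (a h : Vec ℕ k) → (c *ᵛ a) · h ≡ c * (a · h)
·-*ᵛ c []      []      = sym (ℕₚ.*-zeroʳ c)
·-*ᵛ c (x ∷ a) (z ∷ h) rewrite ·-*ᵛ c a h = lemma c x z (a · h)
  where
  lemma : ∀ c x z s → c * x * z + c * s ≡ c * (x * z + s)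
  lemma = solve-∀

·-distribˡ-+ᵛ : ∀ {k} (a b h : Vec ℕ k) → a · (b +ᵛ h) ≡ a · b + a · h
·-distribˡ-+ᵛ a b h = trans (·-comm a (b +ᵛ h)) (trans (·-distribʳ-+ᵛ b h a) (cong₂ _+_ (·-comm b a) (·-comm h a)))

·-*ᵛʳ : ∀ {k} c (a h : Vec ℕ k) → a · (c *ᵛ h) ≡ c * (a · h)
·-*ᵛʳ c a h = trans (·-comm a (c *ᵛ h)) (trans (·-*ᵛ c h a) (cong (c *_) (·-comm h a)))

unit-· : ∀ {k} (i : Fin k) h → unit i · h ≡ lookup h i
unit-· zero    (x ∷ h) = trans (cong₂ _+_ (ℕₚ.*-identityˡ x) (·-zeroˡ h)) (ℕₚ.+-identityʳ x)
unit-· (suc i) (x ∷ h) = unit-· i h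

·-updateAt-suc : ∀ {k} (a h : Vec ℕ k) i → a · updateAt h i suc ≡ lookup a i + a · h
·-updateAt-suc (x ∷ a) (z ∷ h) zero    = lemma x z (a · h)
  where
  lemma : ∀ x z s → x * suc z + s ≡ x + (x * z + s)
  lemma = solve-∀
·-updateAt-suc (x ∷ a) (z ∷ h) (suc i) rewrite ·-updateAt-suc a h i = lemma x z (lookup a i) (a · h)
  where
  lemma : ∀ x z y s → x * z + (y + s) ≡ y + (x * z + s)
  lemma = solve-∀

·-lincomb : ∀ {r k} (a : Vec ℕ r) (vs : Vec (Vec ℕ k) r) h → a · map (_· h) vs ≡ lincomb a vs · h
·-lincomb []       []       h = sym (·-zeroˡ h)
·-lincomb (x ∷ a) (v ∷ vs) h = begin
  x * (v · h) + a · map (_· h) vs          ≡⟨ cong₂ _+_ (sym (·-*ᵛ x v h)) (·-lincomb a vs h) ⟩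
  (x *ᵛ v) · h + lincomb a vs · h          ≡⟨ sym (·-distribʳ-+ᵛ (x *ᵛ v) (lincomb a vs) h) ⟩
  (x *ᵛ v +ᵛ lincomb a vs) · h             ∎
  where open ≡-Reasoning

·-shiftʳ : ∀ {k} d (a e : Vec ℕ k) → a · map (d +_) e ≡ d * sum a + a · e
·-shiftʳ d []      []      = sym (trans (ℕₚ.+-identityʳ (d * 0)) (ℕₚ.*-zeroʳ d))
·-shiftʳ d (x ∷ a) (y ∷ e) rewrite ·-shiftʳ d a e = lemma d x y (sum a) (a · e)
  where
  lemma : ∀ d x y s t → x * (d + y) + (d * s + t) ≡ d * (x + s) + (x * y + t)
  lemma = solve-∀

ones-· : ∀ {k} (e : Vec ℕ k) → replicate k 1 · e ≡ sum e
ones-· []      = refl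
ones-· (y ∷ e) = cong₂ _+_ (ℕₚ.*-identityˡ y) (ones-· e)

-- Weights and the histogram

δ : Bool → ℕ
δ false = 0
δ true  = 1

weightForm : F₂³ → Vec ℕ 8
weightForm c = map (λ x → δ ⟨ c , x ⟩) points

wt-∷ : ∀ {n} b (w : Word n) → wt (b ∷ w) ≡ δ b + wt w
wt-∷ true  w = refl
wt-∷ false w = refl

wt-codeword : ∀ {n} (xs : Vec F₂³ n) c → wt (codeword xs c) ≡ weightForm c · histogram xs
wt-codeword []       c = sym (·-zeroʳ (weightForm c))
wt-codeword (x ∷ xs) c = begin
  wt (⟨ c , x ⟩ ∷ codeword xs c)                                  ≡⟨ wt-∷ ⟨ c , x ⟩ (codeword xs c) ⟩
  δ ⟨ c , x ⟩ + wt (codeword xs c)                                ≡⟨ cong₂ _+_ (sym lookup-weightForm) (wt-codeword xs c) ⟩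
  lookup (weightForm c) (index x) + weightForm c · histogram xs  ≡⟨ sym (·-updateAt-suc (weightForm c) (histogram xs) (index x)) ⟩
  weightForm c · histogram (x ∷ xs)                              ∎
  where
  open ≡-Reasoning
  lookup-weightForm : lookup (weightForm c) (index x) ≡ δ ⟨ c , x ⟩
  lookup-weightForm = trans (Vecₚ.lookup-map (index x) (λ y → δ ⟨ c , y ⟩) points) (cong (λ y → δ ⟨ c , y ⟩) (lookup-points-index x))

weightForms : Vec (Vec ℕ 8) 7
weightForms = tabulate (λ u → weightForm (nonzero u))

weights : Vec ℕ 8 → Vec ℕ 7
weights h = map (_· h) weightForms

lookup-weights : ∀ h u → lookup (weights h) u ≡ weightForm (nonzero u) · h
lookup-weights h u = trans (Vecₚ.lookup-map u (_· h) weightForms) (cong (_· h) (Vecₚ.lookup∘tabulate (λ u → weightForm (nonzero u)) u))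

-- Entry u of offHyperplane v is 1 iff ⟨ nonzero u , nonzero v ⟩ ≡ true; the table is written out
-- rather than computed to keep the exhaustive search below fast.
offHyperplane : Fin 7 → Vec ℕ 7
offHyperplane zero                                = 1 ∷ 0 ∷ 1 ∷ 0 ∷ 1 ∷ 0 ∷ 1 ∷ []
offHyperplane (suc zero)                          = 0 ∷ 1 ∷ 1 ∷ 0 ∷ 0 ∷ 1 ∷ 1 ∷ []
offHyperplane (suc (suc zero))                    = 1 ∷ 1 ∷ 0 ∷ 0 ∷ 1 ∷ 1 ∷ 0 ∷ []
offHyperplane (suc (suc (suc zero)))              = 0 ∷ 0 ∷ 0 ∷ 1 ∷ 1 ∷ 1 ∷ 1 ∷ []
offHyperplane (suc (suc (suc (suc zero))))        = 1 ∷ 0 ∷ 1 ∷ 1 ∷ 0 ∷ 1 ∷ 0 ∷ []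
offHyperplane (suc (suc (suc (suc (suc zero)))))  = 0 ∷ 1 ∷ 1 ∷ 1 ∷ 1 ∷ 0 ∷ 0 ∷ []
offHyperplane (suc (suc (suc (suc (suc (suc zero)))))) = 1 ∷ 1 ∷ 0 ∷ 1 ∷ 0 ∷ 0 ∷ 1 ∷ []

totalWeightForm : Vec ℕ 8
totalWeightForm = lincomb (replicate 7 1) weightForms

inversion-coefficients : ∀ v → lincomb (2 *ᵛ offHyperplane v) weightForms ≡ totalWeightForm +ᵛ 4 *ᵛ unit (suc v)
inversion-coefficients = toWitness {a? = all? λ v → _ ≟ᵛ _} tt

total-coefficients : totalWeightForm +ᵛ 4 *ᵛ unit zero ≡ 4 *ᵛ replicate 8 1
total-coefficients = refl

offHyperplane-size : ∀ v → sum (offHyperplane v) ≡ 4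
offHyperplane-size = toWitness {a? = all? λ v → _ ℕₚ.≟ _} tt

sum-weights≡lincomb : ∀ h → sum (weights h) ≡ totalWeightForm · h
sum-weights≡lincomb h = trans (sym (ones-· (weights h))) (·-lincomb (replicate 7 1) weightForms h)

scaled-unit-· : ∀ {k} (i : Fin k) h → (4 *ᵛ unit i) · h ≡ 4 * lookup h i
scaled-unit-· i h = trans (·-*ᵛ 4 (unit i) h) (cong (4 *_) (unit-· i h))

-- A nonzero column x enters 4 of the 7 weights, and 2 of the 4 weights with ⟨ u , nonzero v ⟩ ≡ true
-- unless x ≡ nonzero v, when it enters all 4.
weights-inversion : ∀ h v → 2 * (offHyperplane v · weights h) ≡ sum (weights h) + 4 * lookup h (suc v)
weights-inversion h v = begin
  2 * (offHyperplane v · weights h)                                   ≡⟨ sym (·-*ᵛ 2 (offHyperplane v) (weights h)) ⟩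
  (2 *ᵛ offHyperplane v) · weights h                                  ≡⟨ ·-lincomb (2 *ᵛ offHyperplane v) weightForms h ⟩
  lincomb (2 *ᵛ offHyperplane v) weightForms · h                      ≡⟨ cong (_· h) (inversion-coefficients v) ⟩
  (totalWeightForm +ᵛ 4 *ᵛ unit (suc v)) · h      ≡⟨ ·-distribʳ-+ᵛ totalWeightForm (4 *ᵛ unit (suc v)) h ⟩
  totalWeightForm · h + (4 *ᵛ unit (suc v)) · h   ≡⟨ cong₂ _+_ (sym (sum-weights≡lincomb h)) (scaled-unit-· (suc v) h) ⟩
  sum (weights h) + 4 * lookup h (suc v)                              ∎
  where open ≡-Reasoning

weights-total : ∀ h → sum (weights h) + 4 * lookup h zero ≡ 4 * sum h
weights-total h = begin
  sum (weights h) + 4 * lookup h zero                                 ≡⟨ cong₂ _+_ (sum-weights≡lincomb h) (sym (scaled-unit-· zero h)) ⟩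
  totalWeightForm · h + (4 *ᵛ unit zero) · h      ≡⟨ sym (·-distribʳ-+ᵛ totalWeightForm (4 *ᵛ unit zero) h) ⟩
  (totalWeightForm +ᵛ 4 *ᵛ unit zero) · h         ≡⟨ cong (_· h) total-coefficients ⟩
  (4 *ᵛ replicate 8 1) · h                                            ≡⟨ ·-*ᵛ 4 (replicate 8 1) h ⟩
  4 * (replicate 8 1 · h)                                             ≡⟨ cong (4 *_) (ones-· h) ⟩
  4 * sum h                                                           ∎
  where open ≡-Reasoning

-- The Gram map modulo 2

odd : ℕ → Bool
odd zero    = false
odd (suc n) = not (odd n)

odd-+ : ∀ m n → odd (m + n) ≡ odd m xor odd n
odd-+ zero    n = refl
odd-+ (suc m) n = trans (cong not (odd-+ m n)) (Boolₚ.not-distribˡ-xor (odd m) (odd n))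

odd-+2 : ∀ x → odd (x + 2) ≡ odd x
odd-+2 zero    = refl
odd-+2 (suc x) = cong not (odd-+2 x)

map-odd-updateAt : ∀ {k} (h : Vec ℕ k) i → map odd (updateAt h i suc) ≡ updateAt (map odd h) i not
map-odd-updateAt (x ∷ h) zero    = refl
map-odd-updateAt (x ∷ h) (suc i) = cong (odd x ∷_) (map-odd-updateAt h i)

if-same : ∀ {A : Set} b (x : A) → (if b then x else x) ≡ x
if-same true  x = refl
if-same false x = refl

if-xor : ∀ {n} (x : Word n) a b → (if a xor b then x else 0w) ≡ (if a then x else 0w) ⊕ (if b then x else 0w)
if-xor x false b     = sym (⊕-identityˡ _)
if-xor x true  false = sym (⊕-identityʳ x)
if-xor x true  true  = sym (⊕-self x)

gramOver : ∀ {k} → Vec F₂³ k → Vec Bool k → F₂³ → F₂³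
gramOver []       []       c = 0w
gramOver (x ∷ xs) (q ∷ qs) c = (if q ∧ ⟨ c , x ⟩ then x else 0w) ⊕ gramOver xs qs c

parityGram : Vec Bool 8 → F₂³ → F₂³
parityGram = gramOver points

gramOver-false : ∀ {k} (xs : Vec F₂³ k) c → gramOver xs (replicate k false) c ≡ 0w
gramOver-false []       c = refl
gramOver-false (x ∷ xs) c = trans (⊕-identityˡ _) (gramOver-false xs c)

gramOver-true : ∀ {k} (xs : Vec F₂³ k) c → gramOver xs (replicate k true) c ≡ gram xs c
gramOver-true []       c = refl
gramOver-true (x ∷ xs) c = cong (_ ⊕_) (gramOver-true xs c)

gramOver-xor : ∀ {k} (xs : Vec F₂³ k) p q c → gramOver xs (zipWith _xor_ p q) c ≡ gramOver xs p c ⊕ gramOver xs q c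
gramOver-xor []       []      []      c = refl
gramOver-xor (x ∷ xs) (a ∷ p) (b ∷ q) c = begin
  (if (a xor b) ∧ t then x else 0w) ⊕ gramOver xs (zipWith _xor_ p q) c
    ≡⟨ cong₂ _⊕_ (trans (cong (λ s → if s then x else 0w) (Boolₚ.∧-distribʳ-xor t a b)) (if-xor x (a ∧ t) (b ∧ t)))
                 (gramOver-xor xs p q c) ⟩
  ((if a ∧ t then x else 0w) ⊕ (if b ∧ t then x else 0w)) ⊕ (gramOver xs p c ⊕ gramOver xs q c)
    ≡⟨ ⊕-interchange _ _ _ _ ⟩
  gramOver (x ∷ xs) (a ∷ p) c ⊕ gramOver (x ∷ xs) (b ∷ q) c ∎
  where
  open ≡-Reasoning
  t = ⟨ c , x ⟩

gramOver-toggle : ∀ {k} (xs : Vec F₂³ k) qs i c →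
  gramOver xs (updateAt qs i not) c ≡ (if ⟨ c , lookup xs i ⟩ then lookup xs i else 0w) ⊕ gramOver xs qs c
gramOver-toggle (x ∷ xs) (q ∷ qs) zero    c = begin
  (if not q ∧ t then x else 0w) ⊕ R
    ≡⟨ cong (λ s → (if s then x else 0w) ⊕ R) (not∧ q) ⟩
  (if (q ∧ t) xor t then x else 0w) ⊕ R
    ≡⟨ cong (_⊕ R) (if-xor x (q ∧ t) t) ⟩
  ((if q ∧ t then x else 0w) ⊕ (if t then x else 0w)) ⊕ R
    ≡⟨ cong (_⊕ R) (⊕-comm _ _) ⟩
  ((if t then x else 0w) ⊕ (if q ∧ t then x else 0w)) ⊕ R
    ≡⟨ ⊕-assoc _ _ R ⟩
  (if t then x else 0w) ⊕ ((if q ∧ t then x else 0w) ⊕ R) ∎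
  where
  open ≡-Reasoning
  t = ⟨ c , x ⟩
  R = gramOver xs qs c
  not∧ : ∀ q → not q ∧ t ≡ (q ∧ t) xor t
  not∧ false = refl
  not∧ true  = sym (Boolₚ.xor-same t)
gramOver-toggle (x ∷ xs) (q ∷ qs) (suc i) c = begin
  X ⊕ gramOver xs (updateAt qs i not) c   ≡⟨ cong (X ⊕_) (gramOver-toggle xs qs i c) ⟩
  X ⊕ (Y ⊕ gramOver xs qs c)              ≡⟨ sym (⊕-assoc X Y _) ⟩
  (X ⊕ Y) ⊕ gramOver xs qs c              ≡⟨ cong (_⊕ gramOver xs qs c) (⊕-comm X Y) ⟩
  (Y ⊕ X) ⊕ gramOver xs qs c              ≡⟨ ⊕-assoc Y X _ ⟩
  Y ⊕ (X ⊕ gramOver xs qs c)              ∎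
  where
  open ≡-Reasoning
  X = if q ∧ ⟨ c , x ⟩ then x else 0w
  Y = if ⟨ c , lookup xs i ⟩ then lookup xs i else 0w

gram≡parityGram : ∀ {n} (xs : Vec F₂³ n) c → gram xs c ≡ parityGram (map odd (histogram xs)) c
gram≡parityGram []       c = sym (gramOver-false points c)
gram≡parityGram (x ∷ xs) c = begin
  (if ⟨ c , x ⟩ then x else 0w) ⊕ gram xs c
    ≡⟨ cong₂ _⊕_ (cong (λ y → if ⟨ c , y ⟩ then y else 0w) (sym (lookup-points-index x))) (gram≡parityGram xs c) ⟩
  (if ⟨ c , lookup points (index x) ⟩ then lookup points (index x) else 0w) ⊕ parityGram (map odd (histogram xs)) c
    ≡⟨ sym (gramOver-toggle points (map odd (histogram xs)) (index x) c) ⟩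
  parityGram (updateAt (map odd (histogram xs)) (index x) not) c
    ≡⟨ cong (λ q → parityGram q c) (sym (map-odd-updateAt (histogram xs) (index x))) ⟩
  parityGram (map odd (histogram (x ∷ xs))) c ∎
  where open ≡-Reasoning

-- Invertible matrices

act-zero : ∀ {k n} (M : Vec (Word n) k) → act M 0w ≡ 0w
act-zero []      = refl
act-zero (r ∷ M) = cong₂ _∷_ (⟨⟩-zeroʳ r) (act-zero M)

Inverse : Matrix → Matrix → Set
Inverse M N = (∀ x → act N (act M (point x)) ≡ point x) × (∀ x → act M (act N (point x)) ≡ point x)

inverse? : ∀ M N → Dec (Inverse M N)
inverse? M N = all? (λ x → act N (act M (point x)) ≟³ point x) ×-dec all? (λ x → act M (act N (point x)) ≟³ point x)

_×₃_ : F₂³ → F₂³ → F₂³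
(a₁ ∷ a₂ ∷ a₃ ∷ []) ×₃ (b₁ ∷ b₂ ∷ b₃ ∷ []) =
  ((a₂ ∧ b₃) xor (a₃ ∧ b₂)) ∷ ((a₃ ∧ b₁) xor (a₁ ∧ b₃)) ∷ ((a₁ ∧ b₂) xor (a₂ ∧ b₁)) ∷ []

fromColumns : F₂³ → F₂³ → F₂³ → Matrix
fromColumns (a₁ ∷ a₂ ∷ a₃ ∷ []) (b₁ ∷ b₂ ∷ b₃ ∷ []) (c₁ ∷ c₂ ∷ c₃ ∷ []) =
  (a₁ ∷ b₁ ∷ c₁ ∷ []) ∷ (a₂ ∷ b₂ ∷ c₂ ∷ []) ∷ (a₃ ∷ b₃ ∷ c₃ ∷ []) ∷ []

-- Over 𝔽₂ an invertible matrix has determinant 1, so its inverse is its adjugate.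
adjugate : Matrix → Matrix
adjugate (r₁ ∷ r₂ ∷ r₃ ∷ []) = fromColumns (r₂ ×₃ r₃) (r₃ ×₃ r₁) (r₁ ×₃ r₂)

-- The code

simplex : Vec F₂³ 7
simplex = tabulate nonzero

copies : (m : ℕ) → Vec F₂³ (m * 7)
copies zero    = []
copies (suc m) = simplex ++ copies m

base : (b : Bool) → Vec F₂³ (7 + 2 * δ b)
base false = map point (# 1 ∷ # 2 ∷ # 4 ∷ # 4 ∷ # 6 ∷ # 7 ∷ # 7 ∷ [])
base true  = map point (# 1 ∷ # 2 ∷ # 4 ∷ # 5 ∷ # 5 ∷ # 6 ∷ # 6 ∷ # 7 ∷ # 7 ∷ [])

baseHistogram : Bool → Vec ℕ 8
baseHistogram false = 0 ∷ 1 ∷ 1 ∷ 0 ∷ 2 ∷ 0 ∷ 1 ∷ 2 ∷ []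
baseHistogram true  = 0 ∷ 1 ∷ 1 ∷ 0 ∷ 1 ∷ 2 ∷ 2 ∷ 2 ∷ []

histogram-base : ∀ b → histogram (base b) ≡ baseHistogram b
histogram-base false = refl
histogram-base true  = refl

codeColumns : (b : Bool) (m : ℕ) → Vec F₂³ (7 + 2 * δ b + m * 7)
codeColumns b m = base b ++ copies m

gram-++ : ∀ {k l} (xs : Vec F₂³ k) (ys : Vec F₂³ l) c → gram (xs ++ ys) c ≡ gram xs c ⊕ gram ys c
gram-++ []       ys c = sym (⊕-identityˡ _)
gram-++ (x ∷ xs) ys c = trans (cong (_ ⊕_) (gram-++ xs ys c)) (sym (⊕-assoc _ _ _))

gram-simplex : ∀ c → gram simplex c ≡ 0w
gram-simplex = ∀-via-points (toWitness {a? = all? λ x → gram simplex (point x) ≟³ 0w} tt)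

gram-copies : ∀ m c → gram (copies m) c ≡ 0w
gram-copies zero    c = refl
gram-copies (suc m) c = begin
  gram (simplex ++ copies m) c          ≡⟨ gram-++ simplex (copies m) c ⟩
  gram simplex c ⊕ gram (copies m) c    ≡⟨ cong₂ _⊕_ (gram-simplex c) (gram-copies m c) ⟩
  0w ⊕ 0w                               ≡⟨⟩
  0w                                    ∎
  where open ≡-Reasoning

gramInjective-base : ∀ b → GramInjective (base b)
gramInjective-base false = ∀-via-points (toWitness {a? = all? λ x → (gram (base false) (point x) ≟³ 0w) →-dec (point x ≟³ 0w)} tt)
gramInjective-base true  = ∀-via-points (toWitness {a? = all? λ x → (gram (base true) (point x) ≟³ 0w) →-dec (point x ≟³ 0w)} tt)

gramInjective-codeColumns : ∀ b m → GramInjective (codeColumns b m)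
gramInjective-codeColumns b m c gram≡0 = gramInjective-base b c (begin
  gram (base b) c                          ≡⟨ sym (⊕-identityʳ _) ⟩
  gram (base b) c ⊕ 0w                     ≡⟨ cong (gram (base b) c ⊕_) (sym (gram-copies m c)) ⟩
  gram (base b) c ⊕ gram (copies m) c      ≡⟨ sym (gram-++ (base b) (copies m) c) ⟩
  gram (codeColumns b m) c                 ≡⟨ gram≡0 ⟩
  0w                                       ∎)
  where open ≡-Reasoning

code : (b : Bool) (m : ℕ) → LinearCode (7 + 2 * δ b + m * 7) 3
code b m = codeFromColumns (codeColumns b m) (gramInjective-codeColumns b m)

code-isLCD : ∀ b m → IsLCD (code b m)
code-isLCD b m = codeFromColumns-isLCD (codeColumns b m) (gramInjective-codeColumns b m)

gramOver-simplex-constant : ∀ q c → gramOver simplex (replicate 7 q) c ≡ 0w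
gramOver-simplex-constant false c = gramOver-false simplex c
gramOver-simplex-constant true  c = trans (gramOver-true simplex c) (gram-simplex c)

parityGram-shift : ∀ (h : Vec ℕ 8) (j : Vec ℕ 7) m → (∀ v → lookup h (suc v) + 2 ≡ m + lookup j v) →
  ∀ c → parityGram (map odd h) c ≡ parityGram (false ∷ map odd j) c
parityGram-shift (h₀ ∷ t) j m shift c = cong₂ _⊕_ (if-same (odd h₀ ∧ ⟨ c , point zero ⟩) (point zero)) (begin
  gramOver simplex (map odd t) c
    ≡⟨ cong (λ q → gramOver simplex q c) parities ⟩
  gramOver simplex (zipWith _xor_ (replicate 7 (odd m)) (map odd j)) c
    ≡⟨ gramOver-xor simplex (replicate 7 (odd m)) (map odd j) c ⟩
  gramOver simplex (replicate 7 (odd m)) c ⊕ gramOver simplex (map odd j) c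
    ≡⟨ cong (_⊕ gramOver simplex (map odd j) c) (gramOver-simplex-constant (odd m) c) ⟩
  0w ⊕ gramOver simplex (map odd j) c
    ≡⟨ ⊕-identityˡ _ ⟩
  gramOver simplex (map odd j) c ∎)
  where
  open ≡-Reasoning
  parities : map odd t ≡ zipWith _xor_ (replicate 7 (odd m)) (map odd j)
  parities = Pointwise-≡⇒≡ (ext λ i → begin
    lookup (map odd t) i                                          ≡⟨ Vecₚ.lookup-map i odd t ⟩
    odd (lookup t i)                                              ≡⟨ sym (odd-+2 (lookup t i)) ⟩
    odd (lookup t i + 2)                                          ≡⟨ cong odd (shift i) ⟩
    odd (m + lookup j i)                                          ≡⟨ odd-+ m (lookup j i) ⟩
    odd m xor odd (lookup j i)
      ≡⟨ sym (cong₂ _xor_ (Vecₚ.lookup-replicate i (odd m)) (Vecₚ.lookup-map i odd j)) ⟩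
    lookup (replicate 7 (odd m)) i xor lookup (map odd j) i       ≡⟨ sym (Vecₚ.lookup-zipWith _xor_ i (replicate 7 (odd m)) (map odd j)) ⟩
    lookup (zipWith _xor_ (replicate 7 (odd m)) (map odd j)) i    ∎)

updateAt-suc-+ᵛ : ∀ {k} (a b : Vec ℕ k) i → updateAt (a +ᵛ b) i suc ≡ updateAt a i suc +ᵛ b
updateAt-suc-+ᵛ (x ∷ a) (y ∷ b) zero    = refl
updateAt-suc-+ᵛ (x ∷ a) (y ∷ b) (suc i) = cong (x + y ∷_) (updateAt-suc-+ᵛ a b i)

histogram-++ : ∀ {k l} (xs : Vec F₂³ k) (ys : Vec F₂³ l) → histogram (xs ++ ys) ≡ histogram xs +ᵛ histogram ys
histogram-++ []       ys = sym (Vecₚ.zipWith-identityˡ ℕₚ.+-identityˡ (histogram ys))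
histogram-++ (x ∷ xs) ys = trans (cong (λ h → updateAt h (index x) suc) (histogram-++ xs ys))
                                 (updateAt-suc-+ᵛ (histogram xs) (histogram ys) (index x))

+ᵛ-*ᵛ : ∀ {k} m (a : Vec ℕ k) → a +ᵛ m *ᵛ a ≡ suc m *ᵛ a
+ᵛ-*ᵛ m []      = refl
+ᵛ-*ᵛ m (x ∷ a) = cong (x + m * x ∷_) (+ᵛ-*ᵛ m a)

histogram-copies : ∀ m → histogram (copies m) ≡ m *ᵛ histogram simplex
histogram-copies zero    = refl
histogram-copies (suc m) = begin
  histogram (simplex ++ copies m)                  ≡⟨ histogram-++ simplex (copies m) ⟩
  histogram simplex +ᵛ histogram (copies m)        ≡⟨ cong (histogram simplex +ᵛ_) (histogram-copies m) ⟩
  histogram simplex +ᵛ m *ᵛ histogram simplex      ≡⟨ +ᵛ-*ᵛ m (histogram simplex) ⟩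
  suc m *ᵛ histogram simplex                       ∎
  where open ≡-Reasoning

histogram-codeColumns : ∀ b m → histogram (codeColumns b m) ≡ histogram (base b) +ᵛ m *ᵛ histogram simplex
histogram-codeColumns b m = trans (histogram-++ (base b) (copies m)) (cong (histogram (base b) +ᵛ_) (histogram-copies m))

wt-codeword-code : ∀ b m c →
  wt (codeword (codeColumns b m) c) ≡ weightForm c · histogram (base b) + m * (weightForm c · histogram simplex)
wt-codeword-code b m c = begin
  wt (codeword (codeColumns b m) c)
    ≡⟨ wt-codeword (codeColumns b m) c ⟩
  weightForm c · histogram (codeColumns b m)
    ≡⟨ cong (weightForm c ·_) (histogram-codeColumns b m) ⟩
  weightForm c · (histogram (base b) +ᵛ m *ᵛ histogram simplex)
    ≡⟨ ·-distribˡ-+ᵛ (weightForm c) (histogram (base b)) (m *ᵛ histogram simplex) ⟩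
  weightForm c · histogram (base b) + weightForm c · (m *ᵛ histogram simplex)
    ≡⟨ cong (weightForm c · histogram (base b) +_) (·-*ᵛʳ m (weightForm c) (histogram simplex)) ⟩
  weightForm c · histogram (base b) + m * (weightForm c · histogram simplex) ∎
  where open ≡-Reasoning

simplex-weight : ∀ i → weightForm (nonzero i) · histogram simplex ≡ 4
simplex-weight = toWitness {a? = all? λ i → _ ℕₚ.≟ _} tt

base-weight-bound : ∀ b i → 3 + δ b ≤ weightForm (nonzero i) · histogram (base b)
base-weight-bound false = toWitness {a? = all? λ i → _ ℕₚ.≤? _} tt
base-weight-bound true  = toWitness {a? = all? λ i → _ ℕₚ.≤? _} tt

base-weight-attained : ∀ b → ∃ λ i → weightForm (nonzero i) · histogram (base b) ≡ 3 + δ b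
base-weight-attained false = toWitness {a? = any? λ i → _ ℕₚ.≟ _} tt
base-weight-attained true  = toWitness {a? = any? λ i → _ ℕₚ.≟ _} tt

wt-0w : ∀ {n} → wt (0w {n}) ≡ 0
wt-0w {zero}  = refl
wt-0w {suc n} = wt-0w {n}

code-minDist : ∀ b m → HasMinDist (code b m) (3 + δ b + m * 4)
code-minDist b m = lower-bound , attained
  where
  xs = codeColumns b m
  wt-nonzero : ∀ i → wt (codeword xs (nonzero i)) ≡ weightForm (nonzero i) · histogram (base b) + m * 4
  wt-nonzero i = trans (wt-codeword-code b m (nonzero i)) (cong (λ s → weightForm (nonzero i) · histogram (base b) + m * s) (simplex-weight i))
  lower-bound : ∀ w → w ∈C code b m → w ≢ 0w → 3 + δ b + m * 4 ≤ wt w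
  lower-bound w (c , refl) w≢0 with zero-or-nonzero c
  ... | inj₁ refl       = ⊥-elim (w≢0 (trans (comb-columns xs 0w) (codeword-zero xs)))
  ... | inj₂ (i , refl) = subst (3 + δ b + m * 4 ≤_) (sym (trans (cong wt (comb-columns xs (nonzero i))) (wt-nonzero i)))
                            (ℕₚ.+-monoˡ-≤ (m * 4) (base-weight-bound b i))
  attained : ∃ λ w → w ∈C code b m × w ≢ 0w × wt w ≡ 3 + δ b + m * 4
  attained with base-weight-attained b
  ... | i , wtᵢ = codeword xs (nonzero i) , (nonzero i , comb-columns xs (nonzero i)) , nonzero-word , wt-min
    where
    wt-min : wt (codeword xs (nonzero i)) ≡ 3 + δ b + m * 4
    wt-min = trans (wt-nonzero i) (cong (_+ m * 4) wtᵢ)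
    nonzero-word : codeword xs (nonzero i) ≢ 0w
    nonzero-word eq = ℕₚ.0≢1+n (trans (sym (wt-0w {7 + 2 * δ b + m * 7})) (trans (cong wt (sym eq)) wt-min))

-- Exhaustive search over excess vectors

-- By weights-inversion, 4 * (h (suc v) + 2) ≡ 4 * m + scaledShape b e v when e is the excess of
-- the weights over the minimum distance (see Classification below).
scaledShape : Bool → Vec ℕ 7 → Fin 7 → ℕ
scaledShape b e v = 11 + δ b + 2 * (offHyperplane v · e) ∸ sum e

shape : Bool → Vec ℕ 7 → Vec ℕ 7
shape b e = tabulate (λ v → scaledShape b e v / 4)

Transforms : Bool → Vec ℕ 7 → Matrix → Set
Transforms b j M = (∀ i → lookup j i ≡ 2 + lookup (baseHistogram b) (index (act M (nonzero i)))) × Inverse M (adjugate M)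

transforms? : ∀ b j M → Dec (Transforms b j M)
transforms? b j M = all? (λ i → _ ℕₚ.≟ _) ×-dec inverse? M (adjugate M)

-- M is determined by its columns M e₁, M e₂, M e₃ = act M (nonzero i) for i = 0, 1, 3, and each
-- must be a point whose base multiplicity is prescribed by j.
candidates : Bool → Vec ℕ 7 → List Matrix
candidates b j =
  concatMap (λ y₁ → concatMap (λ y₂ → List.map (fromColumns y₁ y₂) (fits (# 3))) (fits (# 1))) (fits (# 0))
  where
  fits : Fin 7 → List F₂³
  fits i = filter (λ y → lookup j i ℕₚ.≟ 2 + lookup (baseHistogram b) (index y)) (toList points)

-- An excess vector is resolved when it admits no histogram, gives a degenerate Gram map, or
-- comes from the base histogram by a change of basis.
Resolved : Bool → ℕ → Vec ℕ 7 → Set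
Resolved b x₀ e = (∃ λ v → ¬ 4 ∣ scaledShape b e v)
                ⊎ (∃ λ c → parityGram (false ∷ map odd (shape b e)) (nonzero c) ≡ 0w)
                ⊎ (x₀ ≡ 0 × Any (Transforms b (shape b e)) (candidates b (shape b e)))

resolved? : ∀ b x₀ e → Dec (Resolved b x₀ e)
resolved? b x₀ e = any? (λ v → ¬? (4 ∣? scaledShape b e v))
              ⊎-dec any? (λ c → parityGram (false ∷ map odd (shape b e)) (nonzero c) ≟³ 0w)
              ⊎-dec (x₀ ℕₚ.≟ 0 ×-dec Any.any? (transforms? b (shape b e)) (candidates b (shape b e)))

allUpTo : ℕ → (ℕ → Bool) → Bool
allUpTo zero    p = p 0
allUpTo (suc n) p = p (suc n) ∧ allUpTo n p

allCompositions : (k s : ℕ) → (Vec ℕ k → Bool) → Bool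
allCompositions zero    zero    p = p []
allCompositions zero    (suc s) p = true
allCompositions (suc k) s       p = allUpTo s (λ a → allCompositions k (s ∸ a) (λ v → p (a ∷ v)))

allUpTo-sound : ∀ n p → T (allUpTo n p) → ∀ a → a ≤ n → T (p a)
allUpTo-sound zero    p ok .zero z≤n = ok
allUpTo-sound (suc n) p ok a a≤1+n with ℕₚ.m≤n⇒m<n∨m≡n a≤1+n
... | inj₂ refl      = proj₁ (Equivalence.to Boolₚ.T-∧ ok)
... | inj₁ (s≤s a≤n) = allUpTo-sound n p (proj₂ (Equivalence.to Boolₚ.T-∧ ok)) a a≤n

allCompositions-sound : ∀ k s p → T (allCompositions k s p) → ∀ v → sum v ≡ s → T (p v)
allCompositions-sound zero    .zero p ok []      refl = ok
allCompositions-sound (suc k) s     p ok (a ∷ v) refl =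
  allCompositions-sound k (a + sum v ∸ a) (λ v′ → p (a ∷ v′))
    (allUpTo-sound (a + sum v) _ ok a (ℕₚ.m≤m+n a (sum v))) v (sym (ℕₚ.m+n∸m≡n a (sum v)))

exhaustive : ∀ b → T (allUpTo 2 λ x₀ → allCompositions 7 (7 + δ b ∸ 4 * x₀) λ e → isYes (resolved? b x₀ e))
exhaustive false = tt
exhaustive true  = tt

resolved : ∀ b x₀ e → x₀ ≤ 2 → sum e ≡ 7 + δ b ∸ 4 * x₀ → Resolved b x₀ e
resolved b x₀ e x₀≤2 size =
  toWitness {a? = resolved? b x₀ e} (allCompositions-sound 7 (7 + δ b ∸ 4 * x₀) (λ e → isYes (resolved? b x₀ e))
    (allUpTo-sound 2 (λ x₀ → allCompositions 7 (7 + δ b ∸ 4 * x₀) λ e → isYes (resolved? b x₀ e)) (exhaustive b) x₀ x₀≤2) e size)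

-- Classification of the histograms

divide-by-4 : ∀ x m t → 4 * x ≡ 4 * m + t → 4 ∣ t × x ≡ m + t / 4
divide-by-4 x m t eq with ∣m+n∣m⇒∣n (subst (4 ∣_) eq (m∣m*n x)) (m∣m*n m)
... | 4∣t@(divides q t≡q*4) = 4∣t , ℕₚ.*-cancelˡ-≡ x (m + t / 4) 4 (begin
  4 * x              ≡⟨ eq ⟩
  4 * m + t          ≡⟨ cong (4 * m +_) (trans t≡q*4 (ℕₚ.*-comm q 4)) ⟩
  4 * m + 4 * q      ≡⟨ sym (ℕₚ.*-distribˡ-+ 4 m q) ⟩
  4 * (m + q)        ≡⟨ cong (λ z → 4 * (m + z)) (sym (n/m≡quotient 4∣t)) ⟩
  4 * (m + t / 4)    ∎)
  where open ≡-Reasoning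

+-∸-transpose : ∀ x y z s → s ≤ z → x + s ≡ y + z → x ≡ y + (z ∸ s)
+-∸-transpose x y z s s≤z eq = trans (sym (ℕₚ.m+n∸n≡m x s)) (trans (cong (_∸ s) eq) (ℕₚ.+-∸-assoc y s≤z))

δ≤1 : ∀ b → δ b ≤ 1
δ≤1 false = z≤n
δ≤1 true  = s≤s z≤n

map-+-∸ : ∀ {k} d (w : Vec ℕ k) → (∀ i → d ≤ lookup w i) → map (d +_) (map (_∸ d) w) ≡ w
map-+-∸ d w bound = Pointwise-≡⇒≡ (ext λ i → begin
  lookup (map (d +_) (map (_∸ d) w)) i   ≡⟨ Vecₚ.lookup-map i (d +_) (map (_∸ d) w) ⟩
  d + lookup (map (_∸ d) w) i            ≡⟨ cong (d +_) (Vecₚ.lookup-map i (_∸ d) w) ⟩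
  d + (lookup w i ∸ d)                   ≡⟨ ℕₚ.m+[n∸m]≡n (bound i) ⟩
  lookup w i                             ∎)
  where open ≡-Reasoning

size-arithmetic : ∀ r m → 4 * (7 + 2 * r + m * 7) ≡ (3 + r + m * 4) * 7 + (7 + r)
size-arithmetic = solve-∀

inversion-arithmetic : ∀ r m h A S → 2 * ((3 + r + m * 4) * 4 + A) ≡ ((3 + r + m * 4) * 7 + S) + 4 * h →
                       4 * (h + 2) + S ≡ 4 * m + (11 + r + 2 * A)
inversion-arithmetic r m h A S eq = begin
  4 * (h + 2) + S               ≡⟨ lemma₁ h S ⟩
  (S + 4 * h) + 8               ≡⟨ cong (_+ 8) (sym cancelled) ⟩
  (d + 2 * A) + 8               ≡⟨ lemma₂ r m A ⟩
  4 * m + (11 + r + 2 * A)      ∎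
  where
  open ≡-Reasoning
  d = 3 + r + m * 4
  lemma₀ : ∀ d A → 2 * (d * 4 + A) ≡ d * 7 + (d + 2 * A)
  lemma₀ = solve-∀
  lemma₁ : ∀ h S → 4 * (h + 2) + S ≡ (S + 4 * h) + 8
  lemma₁ = solve-∀
  lemma₂ : ∀ r m A → (3 + r + m * 4 + 2 * A) + 8 ≡ 4 * m + (11 + r + 2 * A)
  lemma₂ = solve-∀
  cancelled : d + 2 * A ≡ S + 4 * h
  cancelled = ℕₚ.+-cancelˡ-≡ (d * 7) _ _ (trans (sym (lemma₀ d A)) (trans eq (ℕₚ.+-assoc (d * 7) S (4 * h))))

module Classification (b : Bool) (m : ℕ) (h : Vec ℕ 8)
                      (size : sum h ≡ 7 + 2 * δ b + m * 7)
                      (bound : ∀ u → 3 + δ b + m * 4 ≤ lookup (weights h) u) where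

  d : ℕ
  d = 3 + δ b + m * 4

  excess : Vec ℕ 7
  excess = map (_∸ d) (weights h)

  weights≡ : weights h ≡ map (d +_) excess
  weights≡ = sym (map-+-∸ d (weights h) bound)

  sum-weights : sum (weights h) ≡ d * 7 + sum excess
  sum-weights = begin
    sum (weights h)                                 ≡⟨ cong sum weights≡ ⟩
    sum (map (d +_) excess)                         ≡⟨ sym (ones-· (map (d +_) excess)) ⟩
    replicate 7 1 · map (d +_) excess               ≡⟨ ·-shiftʳ d (replicate 7 1) excess ⟩
    d * 7 + replicate 7 1 · excess                  ≡⟨ cong (d * 7 +_) (ones-· excess) ⟩
    d * 7 + sum excess                              ∎
    where open ≡-Reasoning

  excess-size : sum excess + 4 * lookup h zero ≡ 7 + δ b
  excess-size = ℕₚ.+-cancelˡ-≡ (d * 7) _ _ (begin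
    d * 7 + (sum excess + 4 * lookup h zero)        ≡⟨ sym (ℕₚ.+-assoc (d * 7) (sum excess) _) ⟩
    d * 7 + sum excess + 4 * lookup h zero          ≡⟨ cong (_+ 4 * lookup h zero) (sym sum-weights) ⟩
    sum (weights h) + 4 * lookup h zero             ≡⟨ weights-total h ⟩
    4 * sum h                                       ≡⟨ cong (4 *_) size ⟩
    4 * (7 + 2 * δ b + m * 7)                       ≡⟨ size-arithmetic (δ b) m ⟩
    d * 7 + (7 + δ b)                               ∎)
    where open ≡-Reasoning

  sum-excess≤ : sum excess ≤ 7 + δ b
  sum-excess≤ = subst (sum excess ≤_) excess-size (ℕₚ.m≤m+n (sum excess) _)

  zeros≤2 : lookup h zero ≤ 2
  zeros≤2 = ℕₚ.*-cancelˡ-≤ 4 (ℕₚ.≤-trans (subst (4 * lookup h zero ≤_) excess-size (ℕₚ.m≤n+m _ (sum excess)))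
                                          (ℕₚ.+-monoʳ-≤ 7 (δ≤1 b)))

  sum-excess : sum excess ≡ 7 + δ b ∸ 4 * lookup h zero
  sum-excess = trans (sym (ℕₚ.m+n∸n≡m (sum excess) (4 * lookup h zero))) (cong (_∸ 4 * lookup h zero) excess-size)

  scaledShape-equation : ∀ v → 4 * (lookup h (suc v) + 2) ≡ 4 * m + scaledShape b excess v
  scaledShape-equation v = +-∸-transpose _ (4 * m) (11 + δ b + 2 * A) (sum excess) S≤
    (inversion-arithmetic (δ b) m (lookup h (suc v)) A (sum excess) (begin
      2 * (d * 4 + A)                               ≡⟨ cong (2 *_) (sym offHyperplane-weights) ⟩
      2 * (offHyperplane v · weights h)             ≡⟨ weights-inversion h v ⟩
      sum (weights h) + 4 * lookup h (suc v)        ≡⟨ cong (_+ 4 * lookup h (suc v)) sum-weights ⟩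
      d * 7 + sum excess + 4 * lookup h (suc v)     ∎))
    where
    open ≡-Reasoning
    A = offHyperplane v · excess
    offHyperplane-weights : offHyperplane v · weights h ≡ d * 4 + A
    offHyperplane-weights = trans (cong (offHyperplane v ·_) weights≡)
      (trans (·-shiftʳ d (offHyperplane v) excess) (cong (λ s → d * s + A) (offHyperplane-size v)))
    S≤ : sum excess ≤ 11 + δ b + 2 * A
    S≤ = ℕₚ.≤-trans sum-excess≤ (ℕₚ.≤-trans (ℕₚ.+-monoˡ-≤ (δ b) (ℕₚ.m≤m+n 7 4)) (ℕₚ.m≤m+n (11 + δ b) (2 * A)))

  scaledShape-divisible : ∀ v → 4 ∣ scaledShape b excess v
  scaledShape-divisible v = proj₁ (divide-by-4 (lookup h (suc v) + 2) m (scaledShape b excess v) (scaledShape-equation v))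

  shape-equation : ∀ v → lookup h (suc v) + 2 ≡ m + lookup (shape b excess) v
  shape-equation v = trans (proj₂ (divide-by-4 (lookup h (suc v) + 2) m (scaledShape b excess v) (scaledShape-equation v)))
                           (cong (m +_) (sym (Vecₚ.lookup∘tabulate (λ v → scaledShape b excess v / 4) v)))

  Classified : Set
  Classified = lookup h zero ≡ 0 × ∃ λ M → Inverse M (adjugate M) ×
                 ∀ i → lookup h (suc i) ≡ m + lookup (baseHistogram b) (index (act M (nonzero i)))

  classify-resolved : (∀ c → parityGram (map odd h) (nonzero c) ≢ 0w) →
                      Resolved b (lookup h zero) excess → Classified
  classify-resolved _ (inj₁ (v , ¬4∣)) = ⊥-elim (¬4∣ (scaledShape-divisible v))
  classify-resolved nondegenerate (inj₂ (inj₁ (c , degenerate))) =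
    ⊥-elim (nondegenerate c (trans (parityGram-shift h (shape b excess) m shape-equation (nonzero c)) degenerate))
  classify-resolved _ (inj₂ (inj₂ (no-zero-columns , found))) = no-zero-columns , transformed (Any.satisfied found)
    where
    transformed : ∃ (Transforms b (shape b excess)) → ∃ λ M → Inverse M (adjugate M) ×
                    ∀ i → lookup h (suc i) ≡ m + lookup (baseHistogram b) (index (act M (nonzero i)))
    transformed (M , matches , inverse) = M , inverse , λ i →
      ℕₚ.+-cancelʳ-≡ 2 _ _ (trans (shape-equation i) (trans (cong (m +_) (matches i)) (move-2 m _)))
      where
      move-2 : ∀ m y → m + (2 + y) ≡ m + y + 2
      move-2 = solve-∀

  classify : (∀ c → parityGram (map odd h) (nonzero c) ≢ 0w) → Classified
  classify nondegenerate = classify-resolved nondegenerate (resolved b (lookup h zero) excess zeros≤2 sum-excess)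

-- Uniqueness

lookup-histogram-code : ∀ b m x →
  lookup (histogram (codeColumns b m)) x ≡ lookup (baseHistogram b) x + m * lookup (histogram simplex) x
lookup-histogram-code b m x = begin
  lookup (histogram (codeColumns b m)) x                              ≡⟨ cong (λ v → lookup v x) (histogram-codeColumns b m) ⟩
  lookup (histogram (base b) +ᵛ m *ᵛ histogram simplex) x             ≡⟨ Vecₚ.lookup-zipWith _+_ x (histogram (base b)) _ ⟩
  lookup (histogram (base b)) x + lookup (m *ᵛ histogram simplex) x  ≡⟨ cong₂ _+_ (cong (λ v → lookup v x) (histogram-base b))
                                                                                    (Vecₚ.lookup-map x (m *_) (histogram simplex)) ⟩
  lookup (baseHistogram b) x + m * lookup (histogram simplex) x       ∎
  where open ≡-Reasoning

no-zero-column-in-base : ∀ b → lookup (baseHistogram b) zero ≡ 0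
no-zero-column-in-base false = refl
no-zero-column-in-base true  = refl

module _ (b : Bool) (m : ℕ) (ys : Vec F₂³ (7 + 2 * δ b + m * 7)) (M : Matrix)
         (NM : ∀ v → act (adjugate M) (act M v) ≡ v) (MN : ∀ v → act M (act (adjugate M) v) ≡ v)
         (no-zero-columns : lookup (histogram ys) zero ≡ 0)
         (nonzero-columns : ∀ i → lookup (histogram ys) (suc i) ≡ m + lookup (baseHistogram b) (index (act M (nonzero i)))) where

  histogram-code≡ : histogram (codeColumns b m) ≡ histogram (map (act M) ys)
  histogram-code≡ = Pointwise-≡⇒≡ (ext λ x → trans (lookup-histogram-code b m x)
    (sym (trans (histogram-map ys (act M) (act N) NM MN x) (entry x))))
    where
    N = adjugate M
    entry : ∀ x → lookup (histogram ys) (index (act N (point x))) ≡ lookup (baseHistogram b) x + m * lookup (histogram simplex) x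
    entry zero    = begin
      lookup (histogram ys) (index (act N 0w))   ≡⟨ cong (λ v → lookup (histogram ys) (index v)) (act-zero N) ⟩
      lookup (histogram ys) zero                 ≡⟨ no-zero-columns ⟩
      0                                          ≡⟨ sym (trans (cong (_+ m * 0) (no-zero-column-in-base b)) (ℕₚ.*-zeroʳ m)) ⟩
      lookup (baseHistogram b) zero + m * 0      ∎
      where open ≡-Reasoning
    entry (suc k) with zero-or-nonzero (act N (point (suc k)))
    ... | inj₁ N≡0 = ⊥-elim (nonzero≢0 k (trans (sym (MN (point (suc k)))) (trans (cong (act M) N≡0) (act-zero M))))
    ... | inj₂ (i , N≡i) = begin
      lookup (histogram ys) (index (act N (point (suc k))))         ≡⟨ cong (λ v → lookup (histogram ys) (index v)) N≡i ⟩
      lookup (histogram ys) (index (nonzero i))                     ≡⟨ cong (lookup (histogram ys)) (index-point (suc i)) ⟩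
      lookup (histogram ys) (suc i)                                 ≡⟨ nonzero-columns i ⟩
      m + lookup (baseHistogram b) (index (act M (nonzero i)))      ≡⟨ cong (λ v → m + lookup (baseHistogram b) (index (act M v))) (sym N≡i) ⟩
      m + lookup (baseHistogram b) (index (act M (act N (point (suc k)))))
                                                                    ≡⟨ cong (λ v → m + lookup (baseHistogram b) (index v)) (MN (point (suc k))) ⟩
      m + lookup (baseHistogram b) (index (point (suc k)))          ≡⟨ cong (λ x → m + lookup (baseHistogram b) x) (index-point (suc k)) ⟩
      m + lookup (baseHistogram b) (suc k)                          ≡⟨ commute m (lookup (baseHistogram b) (suc k)) ⟩
      lookup (baseHistogram b) (suc k) + m * 1                      ≡⟨ cong (λ s → lookup (baseHistogram b) (suc k) + m * s)
                                                                             (sym (Vecₚ.lookup-replicate k 1)) ⟩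
      lookup (baseHistogram b) (suc k) + m * lookup (histogram simplex) (suc k) ∎
      where
      open ≡-Reasoning
      commute : ∀ m y → m + y ≡ y + m * 1
      commute = solve-∀

code-unique : ∀ b m (C′ : LinearCode (7 + 2 * δ b + m * 7) 3) → IsLCD C′ → HasMinDist C′ (3 + δ b + m * 4) →
              Equivalent (code b m) C′
code-unique b m C′ lcd′ (lower-bound′ , _) = equivalent (Classification.classify b m h (sum-histogram ys) bound nondegenerate)
  where
  G′ = gen C′
  ys = columns G′
  h = histogram ys
  bound : ∀ u → 3 + δ b + m * 4 ≤ lookup (weights h) u
  bound u = subst (3 + δ b + m * 4 ≤_) wt≡
    (lower-bound′ (comb G′ (nonzero u)) (nonzero u , refl) (λ eq → nonzero≢0 u (indep C′ (nonzero u) eq)))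
    where
    wt≡ : wt (comb G′ (nonzero u)) ≡ lookup (weights h) u
    wt≡ = trans (cong wt (comb≡codeword G′ (nonzero u))) (trans (wt-codeword ys (nonzero u)) (sym (lookup-weights h u)))
  nondegenerate : ∀ c → parityGram (map odd h) (nonzero c) ≢ 0w
  nondegenerate c eq = nonzero≢0 c (isLCD⇒gramInjective C′ lcd′ (nonzero c) (trans (gram≡parityGram ys (nonzero c)) eq))
  equivalent : Classification.Classified b m h (sum-histogram ys) bound → Equivalent (code b m) C′
  equivalent (no-zero-columns , M , (NM , MN) , nonzero-columns) =
    equivalent-if-columns-match (codeColumns b m) (gramInjective-codeColumns b m) C′ M (adjugate M) (∀-via-points NM) σ
      (λ i → trans (σ-matches i) (Vecₚ.lookup-map i (act M) ys))
    where
    permutation = histogram-permutation (codeColumns b m) (map (act M) ys)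
      (histogram-code≡ b m ys M (∀-via-points NM) (∀-via-points MN) no-zero-columns nonzero-columns)
    σ = proj₁ permutation
    σ-matches = proj₂ permutation

UniqueLCD : ℕ → ℕ → Set
UniqueLCD n d = Σ (LinearCode n 3) λ C → IsLCD C × HasMinDist C d ×
                  (∀ (C′ : LinearCode n 3) → IsLCD C′ → HasMinDist C′ d → Equivalent C C′)

uniqueLCD : ∀ b m → UniqueLCD (7 + 2 * δ b + m * 7) (3 + δ b + m * 4)
uniqueLCD b m = code b m , code-isLCD b m , code-minDist b m , code-unique b m

quotient-arithmetic : ∀ b m → 4 * (7 + 2 * δ b + m * 7) / 7 ∸ 1 ≡ 3 + δ b + m * 4
quotient-arithmetic b m = cong (_∸ 1) (begin
  4 * (7 + 2 * δ b + m * 7) / 7          ≡⟨ DivMod./-congˡ (expand (δ b) m) ⟩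
  (δ b + (4 + δ b + m * 4) * 7) / 7      ≡⟨ DivMod.+-distrib-/-∣ʳ (δ b) (n∣m*n (4 + δ b + m * 4)) ⟩
  δ b / 7 + (4 + δ b + m * 4) * 7 / 7    ≡⟨ cong₂ _+_ (DivMod.m<n⇒m/n≡0 (ℕₚ.≤-trans (s≤s (δ≤1 b)) (ℕₚ.m≤m+n 2 5)))
                                                      (DivMod.m*n/n≡m (4 + δ b + m * 4) 7) ⟩
  4 + δ b + m * 4                        ∎)
  where
  open ≡-Reasoning
  expand : ∀ r m → 4 * (7 + 2 * r + m * 7) ≡ r + (4 + r + m * 4) * 7
  expand = solve-∀

decompose : ∀ n → 7 ≤ n → n % 7 ≡ 0 ⊎ n % 7 ≡ 2 → ∃ λ b → ∃ λ m → n ≡ 7 + 2 * δ b + m * 7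
decompose n 7≤n n%7 with n / 7 | DivMod.m≡m%n+[m/n]*n n 7
... | zero  | n≡ = ⊥-elim (ℕₚ.<⇒≱ (subst (_< 7) (sym (trans n≡ (ℕₚ.+-identityʳ (n % 7)))) (DivMod.m%n<n n 7)) 7≤n)
... | suc m | n≡ with n%7
...   | inj₁ r≡0 = false , m , trans n≡ (cong (_+ suc m * 7) r≡0)
...   | inj₂ r≡2 = true  , m , trans n≡ (cong (_+ suc m * 7) r≡2)

theorem5p12 : ∀ (n : ℕ) → 7 ≤ n → (n % 7 ≡ 0 ⊎ n % 7 ≡ 2) →
    Σ (LinearCode n 3) λ C →
      IsLCD C × HasMinDist C ((4 * n) / 7 ∸ 1) ×
      (∀ (C′ : LinearCode n 3) → IsLCD C′ → HasMinDist C′ ((4 * n) / 7 ∸ 1) →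
        Equivalent C C′)
theorem5p12 n 7≤n n%7 with decompose n 7≤n n%7
... | b , m , refl = subst (UniqueLCD _) (sym (quotient-arithmetic b m)) (uniqueLCD b m)
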